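{- $f\left(\begin{pmatrix}0&0\\1&1\end{pmatrix}\right)=\frac12$.
   Context: Matrices have entries from an arbitrary set of symbols. For an $h\times h$ matrix $H$ and an $n\times n$ matrix $M$ with $n\ge h$, an $h\times h$ submatrix of $M$ is obtained by choosing rows $i_1<\dots<i_h$ and columns $j_1<\dots<j_h$, its $(k,l)$ entry being $M(i_k,j_l)$. The density $d(H,M)$ is the number of $h\times h$ submatrices of $M$ equal to $H$ divided by $\binom{n}{h}^2$. Let $f(H,n)$ be the maximum of $d(H,M)$ over all $n\times n$ matrices $M$, and $f(H)=\lim_{n\to\infty}f(H,n)$. -}

module Defs where

open import Data.Nat using (ℕ; zero; suc; _*_)
open import Data.Nat.Combinatorics using (_C_)
open import Data.Fin using (Fin; zero; suc)
open import Data.Fin.Properties using (all?)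
open import Data.Vec using (Vec; []; _∷_; lookup)
open import Data.List using (List; []; _∷_; map; _++_; length; filter; allFin; cartesianProduct)
open import Data.Product using (_×_; _,_; proj₁; proj₂)
open import Data.Integer using (+_)
open import Data.Rational using (ℚ; 0ℚ; _/_)
open import Relation.Binary.PropositionalEquality using (_≡_)
open import Relation.Nullary using (Dec)
import Data.Nat.Properties as ℕP

-- Symbols are natural numbers (any n×n matrix uses only finitely many symbols).
Matrix : ℕ → Set
Matrix n = Fin n → Fin n → ℕ

choose : ∀ {A : Set} (h : ℕ) → List A → List (Vec A h)
choose zero    xs       = [] ∷ []
choose (suc h) []       = []
choose (suc h) (x ∷ xs) = map (x ∷_) (choose h xs) ++ choose (suc h) xs

increasing : (n h : ℕ) → List (Vec (Fin n) h)
increasing n h = choose h (allFin n)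

Matches : ∀ {h n} → Matrix h → Matrix n → Vec (Fin n) h → Vec (Fin n) h → Set
Matches {h} H M rs cs = ∀ (k l : Fin h) → M (lookup rs k) (lookup cs l) ≡ H k l

matches? : ∀ {h n} (H : Matrix h) (M : Matrix n) (rs cs : Vec (Fin n) h) → Dec (Matches H M rs cs)
matches? H M rs cs = all? (λ k → all? (λ l → M (lookup rs k) (lookup cs l) ℕP.≟ H k l))

count : ∀ {h n} → Matrix h → Matrix n → ℕ
count {h} {n} H M =
  length (filter (λ p → matches? H M (proj₁ p) (proj₂ p))
                 (cartesianProduct (increasing n h) (increasing n h)))

-- d(H,M) = count / (n choose h)^2   (0 if n < h, when the denominator vanishes)
density : ∀ {h n} → Matrix h → Matrix n → ℚ
density {h} {n} H M with (n C h) * (n C h)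
... | zero  = 0ℚ
... | suc k = (+ count H M) / suc k

H₀ : Matrix 2
H₀ zero    _ = 0
H₀ (suc _) _ = 1

-- A copy of H₀ on columns j < j′ needs rows r₁ < r₂ with M r₁ j = 0 and M r₂ j = 1. Looking only
-- at column j, if it has a zeros and b ones then at most a·b ≤ (a + b)²/4 ≤ n²/4 row pairs qualify,
-- so count(H₀, M) ≤ C(n,2)·n²/4 and d(H₀, M) ≤ n/(2(n − 1)) → ½. Conversely, the matrix whose top
-- ⌊n/2⌋ rows are 0 and bottom ⌈n/2⌉ rows are 1 contains H₀ on every pair of columns and every pair
-- of a top and a bottom row, so its density is at least ⌊n/2⌋⌈n/2⌉/C(n,2) ≥ ½.
module Submission where

open import Defs

module Counting where

  open import Data.Nat using (ℕ; zero; suc; _+_; _*_; _≤_; z≤n; ⌊_/2⌋; ⌈_/2⌉; _≟_)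
  open import Data.Nat.Properties
  open import Data.Nat.Combinatorics using (_C_; nC1≡n; nCk+nC[k+1]≡[n+1]C[k+1])
  open import Data.Nat.Tactic.RingSolver using (solve-∀)
  open import Algebra.Properties.CommutativeSemigroup +-commutativeSemigroup using (interchange)
  open import Data.Fin using (Fin; zero; suc; splitAt; _↑ˡ_; _↑ʳ_)
  open import Data.Fin.Properties using (splitAt-↑ˡ; splitAt-↑ʳ)
  open import Data.Vec using (Vec; []; _∷_; lookup)
  open import Data.List
    using (List; []; _∷_; map; _++_; length; filter; tabulate; allFin; cartesianProduct)
  open import Data.List.Properties using (length-++; length-map; length-tabulate)
  open import Data.List.Relation.Unary.All using (All; []; _∷_; universal)
  open import Data.List.Relation.Unary.All.Properties using (tabulate⁺)
  open import Data.Product using (_×_; _,_)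
  open import Data.Sum using ([_,_]′)
  open import Data.Empty using (⊥)
  open import Function using (_∘_; const; id)
  open import Relation.Nullary using (Dec; yes; no; contradiction)
  open import Relation.Unary using (Decidable)
  open import Relation.Binary.PropositionalEquality

  private
    variable
      A B : Set

  𝟙 : ∀ {P : Set} → Dec P → ℕ
  𝟙 (yes _) = 1
  𝟙 (no _)  = 0

  𝟙-accept : ∀ {P : Set} → P → (P? : Dec P) → 𝟙 P? ≡ 1
  𝟙-accept p (yes _) = refl
  𝟙-accept p (no ¬p) = contradiction p ¬p

  𝟙+𝟙≤1 : ∀ {P Q : Set} → (P → Q → ⊥) → (P? : Dec P) (Q? : Dec Q) → 𝟙 P? + 𝟙 Q? ≤ 1
  𝟙+𝟙≤1 disjoint (yes p) (yes q) with () ← disjoint p q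
  𝟙+𝟙≤1 disjoint (yes _) (no _)  = ≤-refl
  𝟙+𝟙≤1 disjoint (no _)  (yes _) = ≤-refl
  𝟙+𝟙≤1 disjoint (no _)  (no _)  = z≤n

  ∑ : List A → (A → ℕ) → ℕ
  ∑ []       f = 0
  ∑ (x ∷ xs) f = f x + ∑ xs f

  syntax ∑ xs (λ x → e) = ∑[ x ∈ xs ] e

  length-filter≡∑𝟙 : ∀ {P : A → Set} (P? : Decidable P) xs →
    length (filter P? xs) ≡ ∑[ x ∈ xs ] 𝟙 (P? x)
  length-filter≡∑𝟙 P? []       = refl
  length-filter≡∑𝟙 P? (x ∷ xs) with P? x
  ... | yes _ = cong suc (length-filter≡∑𝟙 P? xs)
  ... | no _  = length-filter≡∑𝟙 P? xs

  ∑-++ : ∀ xs ys (f : A → ℕ) → ∑ (xs ++ ys) f ≡ ∑ xs f + ∑ ys f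
  ∑-++ []       ys f = refl
  ∑-++ (x ∷ xs) ys f = trans (cong (f x +_) (∑-++ xs ys f)) (sym (+-assoc (f x) _ _))

  ∑-map : ∀ (g : A → B) xs (f : B → ℕ) → ∑ (map g xs) f ≡ ∑[ x ∈ xs ] f (g x)
  ∑-map g []       f = refl
  ∑-map g (x ∷ xs) f = cong (f (g x) +_) (∑-map g xs f)

  ∑-const : ∀ (xs : List A) k → ∑[ x ∈ xs ] k ≡ length xs * k
  ∑-const []       k = refl
  ∑-const (x ∷ xs) k = cong (k +_) (∑-const xs k)

  *-distribˡ-∑ : ∀ k xs (f : A → ℕ) → k * ∑ xs f ≡ ∑[ x ∈ xs ] (k * f x)
  *-distribˡ-∑ k []       f = *-zeroʳ k
  *-distribˡ-∑ k (x ∷ xs) f =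
    trans (*-distribˡ-+ k (f x) _) (cong (k * f x +_) (*-distribˡ-∑ k xs f))

  ∑-distrib-+ : ∀ xs (f g : A → ℕ) → ∑[ x ∈ xs ] (f x + g x) ≡ ∑ xs f + ∑ xs g
  ∑-distrib-+ []       f g = refl
  ∑-distrib-+ (x ∷ xs) f g =
    trans (cong (f x + g x +_) (∑-distrib-+ xs f g)) (interchange (f x) (g x) _ _)

  ∑-mono-≤ : ∀ {xs} {f g : A → ℕ} → All (λ x → f x ≤ g x) xs → ∑ xs f ≤ ∑ xs g
  ∑-mono-≤ []           = z≤n
  ∑-mono-≤ (fx≤gx ∷ le) = +-mono-≤ fx≤gx (∑-mono-≤ le)

  ∑-comm : ∀ xs ys (f : A → B → ℕ) →
    ∑[ x ∈ xs ] ∑[ y ∈ ys ] f x y ≡ ∑[ y ∈ ys ] ∑[ x ∈ xs ] f x y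
  ∑-comm []       ys f = sym (trans (∑-const ys 0) (*-zeroʳ (length ys)))
  ∑-comm (x ∷ xs) ys f =
    trans (cong (∑ ys (f x) +_) (∑-comm xs ys f)) (sym (∑-distrib-+ ys (f x) _))

  ∑-cartesianProduct : ∀ xs ys (f : A × B → ℕ) →
    ∑ (cartesianProduct xs ys) f ≡ ∑[ x ∈ xs ] ∑[ y ∈ ys ] f (x , y)
  ∑-cartesianProduct []       ys f = refl
  ∑-cartesianProduct (x ∷ xs) ys f =
    trans (∑-++ (map (x ,_) ys) _ f) (cong₂ _+_ (∑-map (x ,_) ys f) (∑-cartesianProduct xs ys f))

  ∑-choose₁ : ∀ (xs : List A) (f : Vec A 1 → ℕ) → ∑ (choose 1 xs) f ≡ ∑[ x ∈ xs ] f (x ∷ [])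
  ∑-choose₁ []       f = refl
  ∑-choose₁ (x ∷ xs) f = cong (f (x ∷ []) +_) (∑-choose₁ xs f)

  ∑-choose₂-∷ : ∀ x xs (w : Vec A 2 → ℕ) →
    ∑ (choose 2 (x ∷ xs)) w ≡ ∑[ y ∈ xs ] w (x ∷ y ∷ []) + ∑ (choose 2 xs) w
  ∑-choose₂-∷ x xs w = begin
    ∑ (map (x ∷_) singletons ++ choose 2 xs) w
      ≡⟨ ∑-++ (map (x ∷_) singletons) _ w ⟩
    ∑ (map (x ∷_) singletons) w + ∑ (choose 2 xs) w
      ≡⟨ cong (_+ _) (∑-map (x ∷_) singletons w) ⟩
    ∑[ v ∈ singletons ] w (x ∷ v) + ∑ (choose 2 xs) w
      ≡⟨ cong (_+ _) (∑-choose₁ xs (w ∘ (x ∷_))) ⟩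
    ∑[ y ∈ xs ] w (x ∷ y ∷ []) + ∑ (choose 2 xs) w
      ∎
    where
    open ≡-Reasoning
    singletons = choose 1 xs

  length-choose : ∀ k (xs : List A) → length (choose k xs) ≡ length xs C k
  length-choose zero    xs       = refl
  length-choose (suc k) []       = refl
  length-choose (suc k) (x ∷ xs) = begin
    length (map (x ∷_) (choose k xs) ++ choose (suc k) xs)
      ≡⟨ length-++ (map (x ∷_) (choose k xs)) ⟩
    length (map (x ∷_) (choose k xs)) + length (choose (suc k) xs)
      ≡⟨ cong (_+ _) (length-map (x ∷_) (choose k xs)) ⟩
    length (choose k xs) + length (choose (suc k) xs)
      ≡⟨ cong₂ _+_ (length-choose k xs) (length-choose (suc k) xs) ⟩
    length xs C k + length xs C suc k
      ≡⟨ nCk+nC[k+1]≡[n+1]C[k+1] (length xs) k ⟩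
    suc (length xs) C suc k
      ∎
    where open ≡-Reasoning

  ∑-choose₂≤∑*∑ : ∀ (w : Vec A 2 → ℕ) (f g : A → ℕ) → (∀ x y → w (x ∷ y ∷ []) ≤ f x * g y) →
    ∀ xs → ∑ (choose 2 xs) w ≤ ∑ xs f * ∑ xs g
  ∑-choose₂≤∑*∑ w f g w≤f*g []       = z≤n
  ∑-choose₂≤∑*∑ w f g w≤f*g (x ∷ xs) = begin
    ∑ (choose 2 (x ∷ xs)) w
      ≡⟨ ∑-choose₂-∷ x xs w ⟩
    ∑[ y ∈ xs ] w (x ∷ y ∷ []) + ∑ (choose 2 xs) w
      ≤⟨ +-mono-≤ (∑-mono-≤ (universal (w≤f*g x) xs)) (∑-choose₂≤∑*∑ w f g w≤f*g xs) ⟩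
    ∑[ y ∈ xs ] (f x * g y) + ∑ xs f * ∑ xs g
      ≡⟨ cong (_+ _) (*-distribˡ-∑ (f x) xs g) ⟨
    f x * ∑ xs g + ∑ xs f * ∑ xs g
      ≡⟨ *-distribʳ-+ (∑ xs g) (f x) (∑ xs f) ⟨
    (f x + ∑ xs f) * ∑ xs g
      ≤⟨ *-monoʳ-≤ (f x + ∑ xs f) (m≤n+m (∑ xs g) (g x)) ⟩
    (f x + ∑ xs f) * (g x + ∑ xs g)
      ∎
    where open ≤-Reasoning

  ∑∑≤∑-choose₂-++ : ∀ ys zs (w : Vec A 2 → ℕ) →
    ∑[ y ∈ ys ] ∑[ z ∈ zs ] w (y ∷ z ∷ []) ≤ ∑ (choose 2 (ys ++ zs)) w
  ∑∑≤∑-choose₂-++ []       zs w = z≤n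
  ∑∑≤∑-choose₂-++ (y ∷ ys) zs w = begin
    ∑[ z ∈ zs ] w (y ∷ z ∷ []) + ∑[ y′ ∈ ys ] ∑[ z ∈ zs ] w (y′ ∷ z ∷ [])
      ≤⟨ +-mono-≤ (m≤n+m _ _) (∑∑≤∑-choose₂-++ ys zs w) ⟩
    ∑[ x ∈ ys ] w (y ∷ x ∷ []) + ∑[ z ∈ zs ] w (y ∷ z ∷ []) + ∑ (choose 2 (ys ++ zs)) w
      ≡⟨ cong (_+ _) (∑-++ ys zs (λ x → w (y ∷ x ∷ []))) ⟨
    ∑[ x ∈ ys ++ zs ] w (y ∷ x ∷ []) + ∑ (choose 2 (ys ++ zs)) w
      ≡⟨ ∑-choose₂-∷ y (ys ++ zs) w ⟨
    ∑ (choose 2 (y ∷ ys ++ zs)) w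
      ∎
    where open ≤-Reasoning

  tabulate-↑ : ∀ m {n} (f : Fin (m + n) → A) →
    tabulate f ≡ tabulate (f ∘ (_↑ˡ n)) ++ tabulate (f ∘ (m ↑ʳ_))
  tabulate-↑ zero    f = refl
  tabulate-↑ (suc m) f = cong (f zero ∷_) (tabulate-↑ m (f ∘ suc))

  4*m*n≤[m+n]² : ∀ m n → 4 * (m * n) ≤ (m + n) * (m + n)
  4*m*n≤[m+n]² m n = [ ordered , swap-ordered ]′ (≤-total m n)
    where
    ordered : ∀ {a b} → a ≤ b → 4 * (a * b) ≤ (a + b) * (a + b)
    ordered {a} a≤b with o , refl ← m≤n⇒∃[o]m+o≡n a≤b =
      ≤-trans (m≤m+n _ (o * o)) (≤-reflexive (square a o))
      where
      square : ∀ a o → 4 * (a * (a + o)) + o * o ≡ (a + (a + o)) * (a + (a + o))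
      square = solve-∀
    swap-ordered : n ≤ m → 4 * (m * n) ≤ (m + n) * (m + n)
    swap-ordered n≤m =
      subst₂ _≤_ (cong (4 *_) (*-comm n m)) (cong₂ _*_ (+-comm n m) (+-comm n m)) (ordered n≤m)

  [1+n]C2≡n+nC2 : ∀ n → suc n C 2 ≡ n + n C 2
  [1+n]C2≡n+nC2 n = trans (sym (nCk+nC[k+1]≡[n+1]C[k+1] n 1)) (cong (_+ n C 2) (nC1≡n n))

  2*[1+n]C2≡[1+n]*n : ∀ n → 2 * (suc n C 2) ≡ suc n * n
  2*[1+n]C2≡[1+n]*n zero    = refl
  2*[1+n]C2≡[1+n]*n (suc n) = begin
    2 * (suc (suc n) C 2)        ≡⟨ cong (2 *_) ([1+n]C2≡n+nC2 (suc n)) ⟩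
    2 * (suc n + suc n C 2)      ≡⟨ *-distribˡ-+ 2 (suc n) _ ⟩
    2 * suc n + 2 * (suc n C 2)  ≡⟨ cong (2 * suc n +_) (2*[1+n]C2≡[1+n]*n n) ⟩
    2 * suc n + suc n * n        ≡⟨ expand n ⟩
    suc (suc n) * suc n          ∎
    where
    open ≡-Reasoning
    expand : ∀ n → 2 * suc n + suc n * n ≡ suc (suc n) * suc n
    expand = solve-∀

  nC2≤2*⌊n/2⌋*⌈n/2⌉ : ∀ n → n C 2 ≤ 2 * (⌊ n /2⌋ * ⌈ n /2⌉)
  nC2≤2*⌊n/2⌋*⌈n/2⌉ zero          = z≤n
  nC2≤2*⌊n/2⌋*⌈n/2⌉ (suc zero)    = z≤n
  nC2≤2*⌊n/2⌋*⌈n/2⌉ (suc (suc n)) = begin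
    suc (suc n) C 2
      ≡⟨ trans ([1+n]C2≡n+nC2 (suc n)) (cong (suc n +_) ([1+n]C2≡n+nC2 n)) ⟩
    suc n + (n + n C 2)
      ≤⟨ +-monoʳ-≤ (suc n) (+-monoʳ-≤ n (nC2≤2*⌊n/2⌋*⌈n/2⌉ n)) ⟩
    suc n + (n + 2 * (a * b))
      ≡⟨ cong (λ k → suc k + (k + 2 * (a * b))) (⌊n/2⌋+⌈n/2⌉≡n n) ⟨
    suc (a + b) + (a + b + 2 * (a * b))
      ≤⟨ n≤1+n _ ⟩
    suc (suc (a + b) + (a + b + 2 * (a * b)))
      ≡⟨ expand a b ⟩
    2 * (suc a * suc b)
      ∎
    where
    open ≤-Reasoning
    a = ⌊ n /2⌋
    b = ⌈ n /2⌉
    expand : ∀ a b → suc (suc (a + b) + (a + b + 2 * (a * b))) ≡ 2 * (suc a * suc b)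
    expand = solve-∀

  length-increasing : ∀ n h → length (increasing n h) ≡ n C h
  length-increasing n h =
    trans (length-choose h (allFin n)) (cong (_C h) (length-tabulate {n = n} id))

  count≡∑∑𝟙 : ∀ {h n} (H : Matrix h) (M : Matrix n) →
    count H M ≡ ∑[ cs ∈ increasing n h ] ∑[ rs ∈ increasing n h ] 𝟙 (matches? H M rs cs)
  count≡∑∑𝟙 {h} {n} H M = begin
    count H M
      ≡⟨ length-filter≡∑𝟙 (λ (rs , cs) → matches? H M rs cs) (cartesianProduct I I) ⟩
    ∑[ (rs , cs) ∈ cartesianProduct I I ] 𝟙 (matches? H M rs cs)
      ≡⟨ ∑-cartesianProduct I I (λ (rs , cs) → 𝟙 (matches? H M rs cs)) ⟩
    ∑[ rs ∈ I ] ∑[ cs ∈ I ] 𝟙 (matches? H M rs cs)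
      ≡⟨ ∑-comm I I (λ rs cs → 𝟙 (matches? H M rs cs)) ⟩
    ∑[ cs ∈ I ] ∑[ rs ∈ I ] 𝟙 (matches? H M rs cs)
      ∎
    where
    open ≡-Reasoning
    I = increasing n h

  4*∑𝟙-matches-H₀≤n*n : ∀ {n} (M : Matrix n) cs →
    4 * ∑[ rs ∈ increasing n 2 ] 𝟙 (matches? H₀ M rs cs) ≤ n * n
  4*∑𝟙-matches-H₀≤n*n {n} M cs = begin
    4 * ∑ (choose 2 (allFin n)) w
      ≤⟨ *-monoʳ-≤ 4 (∑-choose₂≤∑*∑ w zeroAt oneAt w≤zeroAt*oneAt (allFin n)) ⟩
    4 * (zeros * ones)
      ≤⟨ 4*m*n≤[m+n]² zeros ones ⟩
    (zeros + ones) * (zeros + ones)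
      ≤⟨ *-mono-≤ zeros+ones≤n zeros+ones≤n ⟩
    n * n
      ∎
    where
    open ≤-Reasoning
    j = lookup cs zero
    w : Vec (Fin n) 2 → ℕ
    w rs = 𝟙 (matches? H₀ M rs cs)
    zeroAt oneAt : Fin n → ℕ
    zeroAt x = 𝟙 (M x j ≟ 0)
    oneAt  x = 𝟙 (M x j ≟ 1)
    zeros ones : ℕ
    zeros = ∑ (allFin n) zeroAt
    ones  = ∑ (allFin n) oneAt
    w≤zeroAt*oneAt : ∀ x y → w (x ∷ y ∷ []) ≤ zeroAt x * oneAt y
    w≤zeroAt*oneAt x y with matches? H₀ M (x ∷ y ∷ []) cs
    ... | no _  = z≤n
    ... | yes m rewrite 𝟙-accept (m zero zero) (M x j ≟ 0)
                      | 𝟙-accept (m (suc zero) zero) (M y j ≟ 1) = ≤-refl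
    zeroAt+oneAt≤1 : ∀ x → zeroAt x + oneAt x ≤ 1
    zeroAt+oneAt≤1 x = 𝟙+𝟙≤1 (λ x≡0 x≡1 → 0≢1+n (trans (sym x≡0) x≡1)) (M x j ≟ 0) (M x j ≟ 1)
    zeros+ones≤n : zeros + ones ≤ n
    zeros+ones≤n = begin
      zeros + ones                           ≡⟨ ∑-distrib-+ (allFin n) zeroAt oneAt ⟨
      ∑[ x ∈ allFin n ] (zeroAt x + oneAt x) ≤⟨ ∑-mono-≤ (universal zeroAt+oneAt≤1 (allFin n)) ⟩
      ∑[ x ∈ allFin n ] 1                    ≡⟨ ∑-const (allFin n) 1 ⟩
      length (allFin n) * 1                  ≡⟨ trans (*-identityʳ _) (length-tabulate {n = n} id) ⟩
      n                                      ∎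

  4*count-H₀≤nC2*n*n : ∀ {n} (M : Matrix n) → 4 * count H₀ M ≤ (n C 2) * (n * n)
  4*count-H₀≤nC2*n*n {n} M = begin
    4 * count H₀ M                                        ≡⟨ cong (4 *_) (count≡∑∑𝟙 H₀ M) ⟩
    4 * ∑[ cs ∈ I ] ∑[ rs ∈ I ] 𝟙 (matches? H₀ M rs cs)   ≡⟨ *-distribˡ-∑ 4 I _ ⟩
    ∑[ cs ∈ I ] (4 * ∑[ rs ∈ I ] 𝟙 (matches? H₀ M rs cs)) ≤⟨ ∑-mono-≤ (universal bound I) ⟩
    ∑[ cs ∈ I ] (n * n)                                   ≡⟨ ∑-const I (n * n) ⟩
    length I * (n * n)                                    ≡⟨ cong (_* (n * n)) (length-increasing n 2) ⟩
    (n C 2) * (n * n)                                     ∎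
    where
    open ≤-Reasoning
    I = increasing n 2
    bound = 4*∑𝟙-matches-H₀≤n*n M

  stepMatrix : ∀ h r → Matrix (h + r)
  stepMatrix h r i _ = [ const 0 , const 1 ]′ (splitAt h i)

  h*r≤∑𝟙-matches-stepMatrix : ∀ h r cs →
    h * r ≤ ∑[ rs ∈ increasing (h + r) 2 ] 𝟙 (matches? H₀ (stepMatrix h r) rs cs)
  h*r≤∑𝟙-matches-stepMatrix h r cs = begin
    h * r
      ≡⟨ cong₂ _*_ (length-tabulate tops) (trans (*-identityʳ _) (length-tabulate bottoms)) ⟨
    length ys * (length zs * 1)
      ≡⟨ trans (∑-const ys _) (cong (length ys *_) (∑-const zs 1)) ⟨
    ∑[ y ∈ ys ] ∑[ z ∈ zs ] 1
      ≤⟨ ∑-mono-≤ (tabulate⁺ λ i → ∑-mono-≤ (tabulate⁺ λ j → 1≤w i j)) ⟩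
    ∑[ y ∈ ys ] ∑[ z ∈ zs ] w (y ∷ z ∷ [])
      ≤⟨ ∑∑≤∑-choose₂-++ ys zs w ⟩
    ∑ (choose 2 (ys ++ zs)) w
      ≡⟨ cong (λ xs → ∑ (choose 2 xs) w) (tabulate-↑ h id) ⟨
    ∑ (choose 2 (allFin (h + r))) w
      ∎
    where
    open ≤-Reasoning
    M = stepMatrix h r
    tops : Fin h → Fin (h + r)
    tops = _↑ˡ r
    bottoms : Fin r → Fin (h + r)
    bottoms = h ↑ʳ_
    ys = tabulate tops
    zs = tabulate bottoms
    w : Vec (Fin (h + r)) 2 → ℕ
    w rs = 𝟙 (matches? H₀ M rs cs)
    1≤w : ∀ i j → 1 ≤ w (tops i ∷ bottoms j ∷ [])
    1≤w i j = ≤-reflexive (sym (𝟙-accept match (matches? H₀ M (tops i ∷ bottoms j ∷ []) cs)))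
      where
      match : Matches H₀ M (tops i ∷ bottoms j ∷ []) cs
      match zero       _ = cong [ const 0 , const 1 ]′ (splitAt-↑ˡ h i r)
      match (suc zero) _ = cong [ const 0 , const 1 ]′ (splitAt-↑ʳ h r j)

  nC2*h*r≤count-stepMatrix : ∀ h r → ((h + r) C 2) * (h * r) ≤ count H₀ (stepMatrix h r)
  nC2*h*r≤count-stepMatrix h r = begin
    ((h + r) C 2) * (h * r)                         ≡⟨ cong (_* (h * r)) (length-increasing (h + r) 2) ⟨
    length I * (h * r)                              ≡⟨ ∑-const I (h * r) ⟨
    ∑[ cs ∈ I ] (h * r)                             ≤⟨ ∑-mono-≤ (universal bound I) ⟩
    ∑[ cs ∈ I ] ∑[ rs ∈ I ] 𝟙 (matches? H₀ M rs cs) ≡⟨ count≡∑∑𝟙 H₀ M ⟨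
    count H₀ M                                      ∎
    where
    open ≤-Reasoning
    M = stepMatrix h r
    I = increasing (h + r) 2
    bound = h*r≤∑𝟙-matches-stepMatrix h r

  count-H₀*2[1+m]≤[2+m]*[[2+m]C2]² : ∀ {m} (M : Matrix (suc (suc m))) →
    count H₀ M * (2 * suc m) ≤ suc (suc m) * ((suc (suc m) C 2) * (suc (suc m) C 2))
  count-H₀*2[1+m]≤[2+m]*[[2+m]C2]² {m} M = *-cancelˡ-≤ 4 (begin
    4 * (count H₀ M * (2 * s)) ≡⟨ *-assoc 4 (count H₀ M) _ ⟨
    4 * count H₀ M * (2 * s)   ≤⟨ *-monoˡ-≤ (2 * s) (4*count-H₀≤nC2*n*n M) ⟩
    K * (n * n) * (2 * s)      ≡⟨ regroup K n s ⟩
    n * K * (2 * (n * s))      ≡⟨ cong (λ k → n * K * (2 * k)) (2*[1+n]C2≡[1+n]*n s) ⟨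
    n * K * (2 * (2 * K))      ≡⟨ regroup′ n K ⟩
    4 * (n * (K * K))          ∎)
    where
    open ≤-Reasoning
    s = suc m
    n = suc s
    K = n C 2
    regroup : ∀ K n s → K * (n * n) * (2 * s) ≡ n * K * (2 * (n * s))
    regroup = solve-∀
    regroup′ : ∀ n K → n * K * (2 * (2 * K)) ≡ 4 * (n * (K * K))
    regroup′ = solve-∀

  [nC2]²≤count-stepMatrix*2 : ∀ h r → (h + r) C 2 ≤ 2 * (h * r) →
    ((h + r) C 2) * ((h + r) C 2) ≤ count H₀ (stepMatrix h r) * 2
  [nC2]²≤count-stepMatrix*2 h r K≤2hr = begin
    K * K                         ≤⟨ *-monoʳ-≤ K K≤2hr ⟩
    K * (2 * (h * r))             ≡⟨ regroup K (h * r) ⟩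
    K * (h * r) * 2               ≤⟨ *-monoˡ-≤ 2 (nC2*h*r≤count-stepMatrix h r) ⟩
    count H₀ (stepMatrix h r) * 2 ∎
    where
    open ≤-Reasoning
    K = (h + r) C 2
    regroup : ∀ K x → K * (2 * x) ≡ K * x * 2
    regroup = solve-∀

open Counting
  using (stepMatrix; [1+n]C2≡n+nC2; nC2≤2*⌊n/2⌋*⌈n/2⌉;
         count-H₀*2[1+m]≤[2+m]*[[2+m]C2]²; [nC2]²≤count-stepMatrix*2)

open import Data.Nat as ℕ using (ℕ; suc; _*_; _≥_; s≤s; ⌊_/2⌋; ⌈_/2⌉)
open import Data.Nat.Properties as ℕ using (⌊n/2⌋+⌈n/2⌉≡n)
open import Data.Nat.Combinatorics using (_C_)
open import Data.Nat.Coprimality using (Coprime)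
open import Data.Nat.Tactic.RingSolver using (solve-∀)
open import Data.Integer as ℤ using (+_; +0; +[1+_]; -[1+_])
open import Data.Integer.Properties using (pos-*)
open import Data.Rational using (ℚ; ½; 0ℚ; mkℚ; _/_; _<_; _≤_; _+_; _-_; positive)
open import Data.Rational.Properties
  using (≤-trans; ≤-reflexive; <⇒≤; +-monoʳ-≤; +-identityʳ; neg-antimono-≤;
         toℚᵘ-cancel-≤; toℚᵘ-fromℚᵘ; module ≤-Reasoning)
import Data.Rational.Unnormalised as ℚᵘ
import Data.Rational.Unnormalised.Properties as ℚᵘ
open import Data.Product using (Σ; _×_; _,_; map₂)
open import Data.Empty using (⊥-elim)
open import Relation.Binary.PropositionalEquality using (_≡_; refl; sym; trans; cong; subst; subst₂)

*≤*⇒/≤/ : ∀ a b c d .{{_ : ℕ.NonZero b}} .{{_ : ℕ.NonZero d}} → a * d ℕ.≤ c * b → + a / b ≤ + c / d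
*≤*⇒/≤/ a b@(suc b-1) c d@(suc d-1) ad≤cb = toℚᵘ-cancel-≤
  (ℚᵘ.≤-respˡ-≃ (ℚᵘ.≃-sym (toℚᵘ-fromℚᵘ (ℚᵘ.mkℚᵘ (+ a) b-1)))
  (ℚᵘ.≤-respʳ-≃ (ℚᵘ.≃-sym (toℚᵘ-fromℚᵘ (ℚᵘ.mkℚᵘ (+ c) d-1)))
  (ℚᵘ.*≤* (subst₂ ℤ._≤_ (pos-* a d) (pos-* c b) (ℤ.+≤+ ad≤cb)))))

p-q≤p : ∀ p {q} → 0ℚ ≤ q → p - q ≤ p
p-q≤p p 0≤q = ≤-trans (+-monoʳ-≤ p (neg-antimono-≤ 0≤q)) (≤-reflexive (+-identityʳ p))

density≡ : ∀ {h n} (H : Matrix h) (M : Matrix n) {k} → n C h ≡ suc k →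
  density H M ≡ + count H M / (suc k * suc k)
density≡ {h} {n} H M eq with (n C h) * (n C h) | cong (λ C → C * C) eq
... | _ | refl = refl

density-H₀≤ : ∀ {m} (M : Matrix (suc (suc m))) → density H₀ M ≤ + suc (suc m) / (2 * suc m)
density-H₀≤ {m} M = begin
  density H₀ M                ≡⟨ density≡ H₀ M C≡ ⟩
  + count H₀ M / (K * K)      ≤⟨ *≤*⇒/≤/ (count H₀ M) (K * K) (suc (suc m)) (2 * suc m) cross ⟩
  + suc (suc m) / (2 * suc m) ∎
  where
  open ≤-Reasoning
  K = suc (m ℕ.+ suc m C 2)
  C≡ : suc (suc m) C 2 ≡ K
  C≡ = [1+n]C2≡n+nC2 (suc m)
  cross : count H₀ M * (2 * suc m) ℕ.≤ suc (suc m) * (K * K)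
  cross = subst (λ C → count H₀ M * (2 * suc m) ℕ.≤ suc (suc m) * (C * C)) C≡
            (count-H₀*2[1+m]≤[2+m]*[[2+m]C2]² M)

½≤density-stepMatrix : ∀ h r {k} → (h ℕ.+ r) C 2 ≡ suc k → (h ℕ.+ r) C 2 ℕ.≤ 2 * (h * r) →
  ½ ≤ density H₀ (stepMatrix h r)
½≤density-stepMatrix h r {k} C≡ C≤2hr = begin
  + 1 / 2                ≤⟨ *≤*⇒/≤/ 1 2 (count H₀ M) (K * K) cross ⟩
  + count H₀ M / (K * K) ≡⟨ density≡ H₀ M C≡ ⟨
  density H₀ M           ∎
  where
  open ≤-Reasoning
  M = stepMatrix h r
  K = suc k
  cross : 1 * (K * K) ℕ.≤ count H₀ M * 2
  cross = subst (λ C → 1 * (C * C) ℕ.≤ count H₀ M * 2) C≡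
            (ℕ.≤-trans (ℕ.≤-reflexive (ℕ.*-identityˡ _)) ([nC2]²≤count-stepMatrix*2 h r C≤2hr))

∃½≤density-H₀ : ∀ m → Σ (Matrix (suc (suc m))) (λ M → ½ ≤ density H₀ M)
∃½≤density-H₀ m = subst (λ n → Σ (Matrix n) (λ M → ½ ≤ density H₀ M)) h+r≡n
  (stepMatrix h r , ½≤density-stepMatrix h r C≡ C≤2hr)
  where
  n = suc (suc m)
  h = ⌊ n /2⌋
  r = ⌈ n /2⌉
  h+r≡n : h ℕ.+ r ≡ n
  h+r≡n = ⌊n/2⌋+⌈n/2⌉≡n n
  C≡ : (h ℕ.+ r) C 2 ≡ suc (m ℕ.+ suc m C 2)
  C≡ = trans (cong (_C 2) h+r≡n) ([1+n]C2≡n+nC2 (suc m))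
  C≤2hr : (h ℕ.+ r) C 2 ℕ.≤ 2 * (h * r)
  C≤2hr = subst (λ k → k C 2 ℕ.≤ 2 * (h * r)) (sym h+r≡n) (nC2≤2*⌊n/2⌋*⌈n/2⌉ n)

[2+m]/2[1+m]≤½+ε : ∀ {m p q} .{c : Coprime (suc p) (suc q)} → q ℕ.≤ m →
  + suc (suc m) / (2 * suc m) ≤ ½ + mkℚ +[1+ p ] q c
[2+m]/2[1+m]≤½+ε {m} {p} {q} {c} q≤m =
  subst (_ ≤_) (sym ½+ε≡) (*≤*⇒/≤/ (suc s) (2 * s) (Q ℕ.+ P * 2) (2 * Q) cross)
  where
  s = suc m
  P = suc p
  Q = suc q
  -- ½ + ε computes to (1 * Q + P * 2) / (2 * Q) from the normal forms of ½ and ε.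
  ½+ε≡ : ½ + mkℚ +[1+ p ] q c ≡ + (Q ℕ.+ P * 2) / (2 * Q)
  ½+ε≡ = cong (λ k → + (k ℕ.+ P * 2) / (2 * Q)) (ℕ.*-identityˡ Q)
  cross : suc s * (2 * Q) ℕ.≤ (Q ℕ.+ P * 2) * (2 * s)
  cross = begin
    suc s * (2 * Q)                       ≡⟨ expand s Q ⟩
    2 * (Q * s) ℕ.+ 2 * Q                 ≤⟨ ℕ.+-monoʳ-≤ (2 * (Q * s)) (ℕ.*-monoʳ-≤ 2 Q≤P*2*s) ⟩
    2 * (Q * s) ℕ.+ 2 * (P * 2 * s)       ≡⟨ expand′ s P Q ⟩
    (Q ℕ.+ P * 2) * (2 * s)               ∎
    where
    open ℕ.≤-Reasoning
    Q≤P*2*s : Q ℕ.≤ P * 2 * s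
    Q≤P*2*s = ℕ.≤-trans (s≤s q≤m) (ℕ.m≤n*m s (P * 2))
    expand : ∀ s Q → suc s * (2 * Q) ≡ 2 * (Q * s) ℕ.+ 2 * Q
    expand = solve-∀
    expand′ : ∀ s P Q → 2 * (Q * s) ℕ.+ 2 * (P * 2 * s) ≡ (Q ℕ.+ P * 2) * (2 * s)
    expand′ = solve-∀

lemma3 : (ε : ℚ) → 0ℚ < ε →
    Σ ℕ (λ N → (n : ℕ) → n ≥ N →
    ((M : Matrix n) → density H₀ M ≤ ½ + ε)
    × Σ (Matrix n) (λ M → ½ - ε ≤ density H₀ M))
lemma3 (mkℚ +0       _ _) 0<ε = ⊥-elim (ℤ.Positive.pos (positive 0<ε))
lemma3 (mkℚ -[1+ _ ] _ _) 0<ε = ⊥-elim (ℤ.Positive.pos (positive 0<ε))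
lemma3 ε@(mkℚ +[1+ p ] q c) 0<ε = suc (suc q) , bounds
  where
  bounds : ∀ n → n ≥ suc (suc q) →
    ((M : Matrix n) → density H₀ M ≤ ½ + ε) × Σ (Matrix n) (λ M → ½ - ε ≤ density H₀ M)
  bounds (suc (suc m)) (s≤s (s≤s q≤m)) =
    (λ M → ≤-trans (density-H₀≤ M) ([2+m]/2[1+m]≤½+ε {c = c} q≤m)) ,
    map₂ (≤-trans (p-q≤p ½ (<⇒≤ 0<ε))) (∃½≤density-H₀ m)
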